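{- Let $G$ be a graph with exactly three connected components and let $k \ge 3$ be an integer. Then $(G,k)$ is niche-realizable if and only if $k=3$ and $G$ is isomorphic to $K_p \cup K_q \cup K_r$ (disjoint union of complete graphs) for some positive integers $p,q,r$.
   Context: All graphs are simple. A $k$-partite tournament is an orientation of a complete $k$-partite graph with $k$ nonempty partite sets. The niche graph $\mathcal{N}(D)$ of a digraph $D$ has vertex set $V(D)$, and two distinct vertices $u,v$ are adjacent iff they have a common out-neighbor in $D$ or a common in-neighbor in $D$. The pair $(G,k)$ is called niche-realizable if $G$ is isomorphic to the niche graph of some $k$-partite tournament. -}

module Defs where

open import Data.Nat using (ℕ; zero; suc; _+_; _<_; _≥_; _<?_)
open import Data.Fin using (Fin; toℕ)
open import Data.Product using (Σ; ∃; ∃-syntax; _×_; _,_)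
open import Data.Sum using (_⊎_)
open import Data.Empty using (⊥)
open import Relation.Nullary using (¬_; yes; no)
open import Relation.Binary.PropositionalEquality using (_≡_; _≢_)
open import Function using (Surjective)

record Graph : Set₁ where
  field
    n      : ℕ
    Adj    : Fin n → Fin n → Set
    sym    : ∀ {u v} → Adj u v → Adj v u
    irrefl : ∀ {u} → ¬ Adj u u
open Graph public

data Reach (G : Graph) : Fin (n G) → Fin (n G) → Set where
  here : ∀ {u} → Reach G u u
  step : ∀ {u v w} → Adj G u v → Reach G v w → Reach G u w

ThreeComponents : Graph → Set
ThreeComponents G =
  Σ (Fin (n G)) λ a → Σ (Fin (n G)) λ b → Σ (Fin (n G)) λ c →
    ¬ Reach G a b × ¬ Reach G a c × ¬ Reach G b c ×
    (∀ v → Reach G v a ⊎ Reach G v b ⊎ Reach G v c)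

record _≅_ (G H : Graph) : Set where
  field
    to      : Fin (n G) → Fin (n H)
    from    : Fin (n H) → Fin (n G)
    from∘to : ∀ x → from (to x) ≡ x
    to∘from : ∀ y → to (from y) ≡ y
    pres    : ∀ u v → Adj G u v → Adj H (to u) (to v)
    refl'   : ∀ u v → Adj H (to u) (to v) → Adj G u v

record Digraph : Set₁ where
  field
    m   : ℕ
    Arc : Fin m → Fin m → Set

record IsMultipartiteTournament (k : ℕ) (D : Digraph) : Set where
  open Digraph D
  field
    part       : Fin m → Fin k
    part-surj  : ∀ (i : Fin k) → ∃[ v ] part v ≡ i
    noArcIn    : ∀ u v → part u ≡ part v → ¬ Arc u v
    someArc    : ∀ u v → part u ≢ part v → Arc u v ⊎ Arc v u
    notBoth    : ∀ u v → ¬ (Arc u v × Arc v u)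

NicheAdj : (D : Digraph) → Fin (Digraph.m D) → Fin (Digraph.m D) → Set
NicheAdj D u v =
  u ≢ v × ((∃[ w ] (Arc u w × Arc v w)) ⊎ (∃[ w ] (Arc w u × Arc w v)))
  where open Digraph D

niche : Digraph → Graph
niche D = record
  { n = Digraph.m D
  ; Adj = NicheAdj D
  ; sym = λ { (u≢v , Data.Sum.inj₁ (w , a , b)) → (λ e → u≢v (Relation.Binary.PropositionalEquality.sym e)) , Data.Sum.inj₁ (w , b , a)
            ; (u≢v , Data.Sum.inj₂ (w , a , b)) → (λ e → u≢v (Relation.Binary.PropositionalEquality.sym e)) , Data.Sum.inj₂ (w , b , a) }
  ; irrefl = λ { (u≢u , _) → u≢u Relation.Binary.PropositionalEquality.refl }
  }
  where import Data.Sum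
        import Relation.Binary.PropositionalEquality

NicheRealizable : Graph → ℕ → Set₁
NicheRealizable G k =
  Σ Digraph λ D → IsMultipartiteTournament k D × (G ≅ niche D)

-- Block index (0, 1 or 2) of a vertex of K_p ∪ K_q ∪ K_r, whose vertex set is
-- Fin (p + q + r): the first p vertices, the next q, the last r.
block : (p q r : ℕ) → Fin (p + q + r) → ℕ
block p q r i with toℕ i <? p
... | yes _ = 0
... | no _ with toℕ i <? p + q
...   | yes _ = 1
...   | no _ = 2

K3 : (p q r : ℕ) → Graph
K3 p q r = record
  { n = p + q + r
  ; Adj = λ i j → block p q r i ≡ block p q r j × i ≢ j
  ; sym = λ { (e , d) → Relation.Binary.PropositionalEquality.sym e , (λ x → d (Relation.Binary.PropositionalEquality.sym x)) }
  ; irrefl = λ { (_ , d) → d Relation.Binary.PropositionalEquality.refl }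
  }
  where import Relation.Binary.PropositionalEquality

-- In a multipartite tournament, a vertex w and three vertices x, y, z outside
-- its part span three arcs, two of which point the same way, so two of x, y, z
-- share the neighbour w in the niche graph.  Taking x, y, z to be
-- representatives of the three components of the niche graph, this shows that
-- every part contains one of them (so k = 3 and they lie in distinct parts),
-- that no component leaves the part of its representative, and that any two
-- vertices of one part have a common neighbour in the part of another
-- representative.  So the components are the three parts, and each is a
-- clique.  Conversely, orienting every arc from block i to block i + 1 (mod 3)
-- of K_p ∪ K_q ∪ K_r gives a 3-partite tournament whose niche graph is
-- K_p ∪ K_q ∪ K_r.
module Submission where

open import Defs
open import Data.Nat using (ℕ; zero; suc; _+_; _≤_; _<_; _≥_; _<?_; >-nonZero⁻¹)
import Data.Nat.Properties as ℕ
open import Data.Fin using (Fin; zero; suc; toℕ; fromℕ<; splitAt; punchIn; punchOut; _≟_)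
open import Data.Fin.Patterns using (0F; 1F; 2F)
open import Data.Fin.Properties
  using ( any?; nonZeroIndex; +↔⊎; toℕ-injective; toℕ-fromℕ<; splitAt-<; splitAt-≥
        ; injective⇒≤; punchIn-punchOut )
open import Data.Product using (Σ; ∃-syntax; _×_; _,_; proj₁; proj₂)
open import Data.Sum using (_⊎_; inj₁; inj₂)
open import Data.Sum.Algebra using (⊎-cong)
open import Function using (_∘_)
open import Function.Bundles using (_↔_; Inverse; mk↔ₛ′)
open import Function.Definitions using (StrictlySurjective)
open import Function.Construct.Composition using (_↔-∘_)
open import Function.Construct.Identity using (↔-id)
open import Function.Construct.Symmetry using (↔-sym)
open import Relation.Nullary using (¬_; yes; no; contradiction)
open import Relation.Binary.PropositionalEquality as ≡
  using (_≡_; _≢_; refl; cong; subst; subst₂)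

surjective⇒≤ : ∀ {n k} (g : Fin n → Fin k) → StrictlySurjective _≡_ g → k ≤ n
surjective⇒≤ {n} {k} g surj = injective⇒≤ section-injective
  where
  section : Fin k → Fin n
  section i = proj₁ (surj i)
  section-injective : ∀ {i j} → section i ≡ section j → i ≡ j
  section-injective {i} {j} e =
    ≡.trans (≡.sym (proj₂ (surj i))) (≡.trans (cong g e) (proj₂ (surj j)))

-- Collapsing two points with the same image leaves a surjection from a
-- smaller set.
surjective-collision⇒≤ : ∀ {n k} (g : Fin (suc n) → Fin k) → StrictlySurjective _≡_ g →
                         ∀ {s t} → s ≢ t → g s ≡ g t → k ≤ n
surjective-collision⇒≤ g surj {s} {t} s≢t gs≡gt = surjective⇒≤ (g ∘ punchIn s) preimage
  where
  preimage : StrictlySurjective _≡_ (g ∘ punchIn s)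
  preimage i with surj i
  ... | u , gu≡i with s ≟ u
  ...   | yes refl =
    punchOut s≢t , ≡.trans (cong g (punchIn-punchOut s≢t)) (≡.trans (≡.sym gs≡gt) gu≡i)
  ...   | no s≢u   = punchOut s≢u , ≡.trans (cong g (punchIn-punchOut s≢u)) gu≡i

surjective⇒injective : ∀ {n k} (g : Fin n → Fin k) → StrictlySurjective _≡_ g → n ≤ k →
                       ∀ {s t} → g s ≡ g t → s ≡ t
surjective⇒injective {suc n} g surj n≤k {s} {t} gs≡gt with s ≟ t
... | yes s≡t = s≡t
... | no s≢t  =
  contradiction (ℕ.≤-trans n≤k (surjective-collision⇒≤ g surj s≢t gs≡gt)) ℕ.1+n≰n

rotate : Fin 3 → Fin 3
rotate 0F = 1F
rotate 1F = 2F
rotate 2F = 0F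

rotate³≡id : ∀ t → rotate (rotate (rotate t)) ≡ t
rotate³≡id 0F = refl
rotate³≡id 1F = refl
rotate³≡id 2F = refl

rotate-injective : ∀ {s t} → rotate s ≡ rotate t → s ≡ t
rotate-injective {s} {t} e =
  ≡.trans (≡.sym (rotate³≡id s)) (≡.trans (cong (rotate ∘ rotate) e) (rotate³≡id t))

rotate-fixfree : ∀ t → rotate t ≢ t
rotate-fixfree 0F ()
rotate-fixfree 1F ()
rotate-fixfree 2F ()

rotate²-fixfree : ∀ t → rotate (rotate t) ≢ t
rotate²-fixfree 0F ()
rotate²-fixfree 1F ()
rotate²-fixfree 2F ()

rotate-asym : ∀ {s t} → rotate s ≡ t → rotate t ≢ s
rotate-asym {s} refl = rotate²-fixfree s

rotate-total : ∀ s t → s ≢ t → rotate s ≡ t ⊎ rotate t ≡ s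
rotate-total 0F 0F s≢t = contradiction refl s≢t
rotate-total 0F 1F _   = inj₁ refl
rotate-total 0F 2F _   = inj₂ refl
rotate-total 1F 0F _   = inj₂ refl
rotate-total 1F 1F s≢t = contradiction refl s≢t
rotate-total 1F 2F _   = inj₁ refl
rotate-total 2F 0F _   = inj₁ refl
rotate-total 2F 1F _   = inj₂ refl
rotate-total 2F 2F s≢t = contradiction refl s≢t

module _ {G : Graph} where

  reach-trans : ∀ {u v w} → Reach G u v → Reach G v w → Reach G u w
  reach-trans here         r = r
  reach-trans (step uv vw) r = step uv (reach-trans vw r)

  reach-sym : ∀ {u v} → Reach G u v → Reach G v u
  reach-sym here        = here
  reach-sym (step uv r) = reach-trans (reach-sym r) (step (sym G uv) here)

reach-map : ∀ {G H} (f : Fin (n G) → Fin (n H)) →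
            (∀ {u v} → Adj G u v → Adj H (f u) (f v)) →
            ∀ {u v} → Reach G u v → Reach H (f u) (f v)
reach-map f f-adj here        = here
reach-map f f-adj (step uv r) = step (f-adj uv) (reach-map f f-adj r)

≅-trans : ∀ {G H J} → G ≅ H → H ≅ J → G ≅ J
≅-trans φ ψ = record
  { to      = to ψ ∘ to φ
  ; from    = from φ ∘ from ψ
  ; from∘to = λ x → ≡.trans (cong (from φ) (from∘to ψ (to φ x))) (from∘to φ x)
  ; to∘from = λ y → ≡.trans (cong (to ψ) (to∘from φ (from ψ y))) (to∘from ψ y)
  ; pres    = λ u v → pres ψ _ _ ∘ pres φ u v
  ; refl'   = λ u v → refl' φ u v ∘ refl' ψ _ _
  }
  where open _≅_

≅-from-pres : ∀ {G H} (φ : G ≅ H) → ∀ {x y} →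
              Adj H x y → Adj G (_≅_.from φ x) (_≅_.from φ y)
≅-from-pres {H = H} φ {x} {y} xy =
  refl' (from x) (from y) (subst₂ (Adj H) (≡.sym (to∘from x)) (≡.sym (to∘from y)) xy)
  where open _≅_ φ

record ThreeRepresentatives (G : Graph) : Set where
  field
    rep       : Fin 3 → Fin (n G)
    separated : ∀ {s t} → s ≢ t → ¬ Reach G (rep s) (rep t)
    covering  : ∀ v → ∃[ t ] Reach G v (rep t)

threeRepresentatives : ∀ {G} → ThreeComponents G → ThreeRepresentatives G
threeRepresentatives {G} (a , b , c , ¬ab , ¬ac , ¬bc , cover) = record
  { rep = rep ; separated = separated ; covering = covering }
  where
  rep : Fin 3 → Fin (n G)
  rep 0F = a
  rep 1F = b
  rep 2F = c
  separated : ∀ {s t} → s ≢ t → ¬ Reach G (rep s) (rep t)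
  separated {0F} {0F} s≢t = contradiction refl s≢t
  separated {0F} {1F} _   = ¬ab
  separated {0F} {2F} _   = ¬ac
  separated {1F} {0F} _   = ¬ab ∘ reach-sym
  separated {1F} {1F} s≢t = contradiction refl s≢t
  separated {1F} {2F} _   = ¬bc
  separated {2F} {0F} _   = ¬ac ∘ reach-sym
  separated {2F} {1F} _   = ¬bc ∘ reach-sym
  separated {2F} {2F} s≢t = contradiction refl s≢t
  covering : ∀ v → ∃[ t ] Reach G v (rep t)
  covering v with cover v
  ... | inj₁ r        = 0F , r
  ... | inj₂ (inj₁ r) = 1F , r
  ... | inj₂ (inj₂ r) = 2F , r

threeRepresentatives-≅ : ∀ {G H} → G ≅ H → ThreeRepresentatives G → ThreeRepresentatives H
threeRepresentatives-≅ {G} {H} φ R = record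
  { rep       = to ∘ rep
  ; separated = λ s≢t r → separated s≢t
      (subst₂ (Reach G) (from∘to _) (from∘to _) (reach-map from (≅-from-pres φ) r))
  ; covering  = λ v → let (t , r) = covering (from v) in
      t , subst (λ x → Reach H x (to (rep t))) (to∘from v) (reach-map to (pres _ _) r)
  }
  where open _≅_ φ
        open ThreeRepresentatives R

record CliquePartition {C : Set} (G : Graph) (f : Fin (n G) → C) : Set where
  field
    adjacent⇒same : ∀ {u v} → Adj G u v → f u ≡ f v
    same⇒adjacent : ∀ {u v} → f u ≡ f v → u ≢ v → Adj G u v

cliquePartition-≅ : ∀ {C : Set} {G H} {f : Fin (n G) → C} {g : Fin (n H) → C} →
                    CliquePartition G f → CliquePartition H g →
                    (σ : Fin (n G) ↔ Fin (n H)) → (∀ u → g (Inverse.to σ u) ≡ f u) →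
                    G ≅ H
cliquePartition-≅ {G = G} {H = H} cpG cpH σ g∘σ≡f = record
  { to      = to
  ; from    = from
  ; from∘to = strictlyInverseʳ
  ; to∘from = strictlyInverseˡ
  ; pres    = λ u v uv → same⇒adjacent cpH
      (≡.trans (g∘σ≡f u) (≡.trans (adjacent⇒same cpG uv) (≡.sym (g∘σ≡f v))))
      (λ σu≡σv → irrefl G (subst (Adj G u) (≡.sym (σ-injective σu≡σv)) uv))
  ; refl'   = λ u v σuσv → same⇒adjacent cpG
      (≡.trans (≡.sym (g∘σ≡f u)) (≡.trans (adjacent⇒same cpH σuσv) (g∘σ≡f v)))
      (λ { refl → irrefl H σuσv })
  }
  where
  open Inverse σ
  open CliquePartition
  σ-injective : ∀ {u v} → to u ≡ to v → u ≡ v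
  σ-injective {u} {v} e =
    ≡.trans (≡.sym (strictlyInverseʳ u)) (≡.trans (cong from e) (strictlyInverseʳ v))

Blocks : ℕ × ℕ × ℕ → Set
Blocks (p , q , r) = (Fin p ⊎ Fin q) ⊎ Fin r

tag : ∀ {s} → Blocks s → Fin 3
tag (inj₁ (inj₁ _)) = 0F
tag (inj₁ (inj₂ _)) = 1F
tag (inj₂ _)        = 2F

blocks↔ : ∀ p q r → Fin (p + q + r) ↔ Blocks (p , q , r)
blocks↔ p q r = ⊎-cong +↔⊎ (↔-id (Fin r)) ↔-∘ +↔⊎

blockClass : ∀ p q r → Fin (p + q + r) → Fin 3
blockClass p q r = tag ∘ Inverse.to (blocks↔ p q r)

block≡blockClass : ∀ p q r i → block p q r i ≡ toℕ (blockClass p q r i)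
block≡blockClass p q r i with toℕ i <? p
... | yes i<p
  rewrite splitAt-< (p + q) i (ℕ.m≤n⇒m≤n+o q i<p)
        | splitAt-< p (fromℕ< (ℕ.m≤n⇒m≤n+o q i<p))
                      (subst (_< p) (≡.sym (toℕ-fromℕ< _)) i<p)
        = refl
... | no i≮p with toℕ i <? p + q
...   | yes i<p+q
  rewrite splitAt-< (p + q) i i<p+q
        | splitAt-≥ p (fromℕ< i<p+q)
                      (subst (_≥ p) (≡.sym (toℕ-fromℕ< i<p+q)) (ℕ.≮⇒≥ i≮p))
        = refl
...   | no i≮p+q rewrite splitAt-≥ (p + q) i (ℕ.≮⇒≥ i≮p+q) = refl

K3-cliquePartition : ∀ p q r → CliquePartition (K3 p q r) (blockClass p q r)
K3-cliquePartition p q r = record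
  { adjacent⇒same = λ {u} {v} (same , _) →
      toℕ-injective (≡.trans (≡.sym (block≡ u)) (≡.trans same (block≡ v)))
  ; same⇒adjacent = λ {u} {v} e u≢v →
      ≡.trans (block≡ u) (≡.trans (cong toℕ e) (≡.sym (block≡ v))) , u≢v
  }
  where
  block≡ : ∀ i → block p q r i ≡ toℕ (blockClass p q r i)
  block≡ = block≡blockClass p q r

grow : Fin 3 → ℕ × ℕ × ℕ → ℕ × ℕ × ℕ
grow 0F (p , q , r) = suc p , q , r
grow 1F (p , q , r) = p , suc q , r
grow 2F (p , q , r) = p , q , suc r

insert : ∀ t s → (Fin 1 ⊎ Blocks s) ↔ Blocks (grow t s)
insert 0F _ = mk↔ₛ′
  (λ { (inj₁ _)                → inj₁ (inj₁ zero)
     ; (inj₂ (inj₁ (inj₁ i))) → inj₁ (inj₁ (suc i))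
     ; (inj₂ (inj₁ (inj₂ j))) → inj₁ (inj₂ j)
     ; (inj₂ (inj₂ k))        → inj₂ k })
  (λ { (inj₁ (inj₁ zero))    → inj₁ zero
     ; (inj₁ (inj₁ (suc i))) → inj₂ (inj₁ (inj₁ i))
     ; (inj₁ (inj₂ j))       → inj₂ (inj₁ (inj₂ j))
     ; (inj₂ k)              → inj₂ (inj₂ k) })
  (λ { (inj₁ (inj₁ zero)) → refl ; (inj₁ (inj₁ (suc _))) → refl
     ; (inj₁ (inj₂ _))    → refl ; (inj₂ _)              → refl })
  (λ { (inj₁ zero)             → refl ; (inj₂ (inj₁ (inj₁ _))) → refl
     ; (inj₂ (inj₁ (inj₂ _))) → refl ; (inj₂ (inj₂ _))        → refl })
insert 1F _ = mk↔ₛ′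
  (λ { (inj₁ _)                → inj₁ (inj₂ zero)
     ; (inj₂ (inj₁ (inj₁ i))) → inj₁ (inj₁ i)
     ; (inj₂ (inj₁ (inj₂ j))) → inj₁ (inj₂ (suc j))
     ; (inj₂ (inj₂ k))        → inj₂ k })
  (λ { (inj₁ (inj₂ zero))    → inj₁ zero
     ; (inj₁ (inj₂ (suc j))) → inj₂ (inj₁ (inj₂ j))
     ; (inj₁ (inj₁ i))       → inj₂ (inj₁ (inj₁ i))
     ; (inj₂ k)              → inj₂ (inj₂ k) })
  (λ { (inj₁ (inj₂ zero)) → refl ; (inj₁ (inj₂ (suc _))) → refl
     ; (inj₁ (inj₁ _))    → refl ; (inj₂ _)              → refl })
  (λ { (inj₁ zero)             → refl ; (inj₂ (inj₁ (inj₁ _))) → refl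
     ; (inj₂ (inj₁ (inj₂ _))) → refl ; (inj₂ (inj₂ _))        → refl })
insert 2F _ = mk↔ₛ′
  (λ { (inj₁ _)         → inj₂ zero
     ; (inj₂ (inj₁ b)) → inj₁ b
     ; (inj₂ (inj₂ k)) → inj₂ (suc k) })
  (λ { (inj₂ zero)    → inj₁ zero
     ; (inj₂ (suc k)) → inj₂ (inj₂ k)
     ; (inj₁ b)       → inj₂ (inj₁ b) })
  (λ { (inj₂ zero) → refl ; (inj₂ (suc _)) → refl ; (inj₁ _) → refl })
  (λ { (inj₁ zero) → refl ; (inj₂ (inj₁ _)) → refl ; (inj₂ (inj₂ _)) → refl })

tag-insert-new : ∀ t s → tag (Inverse.to (insert t s) (inj₁ zero)) ≡ t
tag-insert-new 0F _ = refl
tag-insert-new 1F _ = refl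
tag-insert-new 2F _ = refl

tag-insert-old : ∀ t s (b : Blocks s) → tag (Inverse.to (insert t s) (inj₂ b)) ≡ tag b
tag-insert-old 0F _ (inj₁ (inj₁ _)) = refl
tag-insert-old 0F _ (inj₁ (inj₂ _)) = refl
tag-insert-old 0F _ (inj₂ _)        = refl
tag-insert-old 1F _ (inj₁ (inj₁ _)) = refl
tag-insert-old 1F _ (inj₁ (inj₂ _)) = refl
tag-insert-old 1F _ (inj₂ _)        = refl
tag-insert-old 2F _ (inj₁ (inj₁ _)) = refl
tag-insert-old 2F _ (inj₁ (inj₂ _)) = refl
tag-insert-old 2F _ (inj₂ _)        = refl

record BlockSorting {m} (f : Fin m → Fin 3) : Set where
  field
    sizes    : ℕ × ℕ × ℕ
    sort     : Fin m ↔ Blocks sizes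
    tag-sort : ∀ u → tag (Inverse.to sort u) ≡ f u

blockSorting : ∀ {m} (f : Fin m → Fin 3) → BlockSorting f
blockSorting {zero} f = record { sizes = 0 , 0 , 0 ; sort = blocks↔ 0 0 0 ; tag-sort = λ () }
blockSorting {suc m} f = record
  { sizes    = grow (f zero) sizes
  ; sort     = insert (f zero) sizes ↔-∘ (⊎-cong (↔-id (Fin 1)) sort ↔-∘ +↔⊎)
  ; tag-sort = λ { zero → tag-insert-new (f zero) sizes
                 ; (suc u) → ≡.trans (tag-insert-old (f zero) sizes _) (tag-sort u) }
  }
  where open BlockSorting (blockSorting (f ∘ suc))

tags-surjective⇒positive : ∀ {p q r} → StrictlySurjective _≡_ (tag {p , q , r}) →
                           0 < p × 0 < q × 0 < r
tags-surjective⇒positive surj with surj 0F | surj 1F | surj 2F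
... | inj₁ (inj₁ i) , _ | inj₁ (inj₂ j) , _ | inj₂ k , _ = positive i , positive j , positive k
  where positive : ∀ {n} → Fin n → 0 < n
        positive i = >-nonZero⁻¹ _ {{nonZeroIndex i}}
... | inj₁ (inj₂ _) , () | _ | _
... | inj₂ _ , ()        | _ | _
... | _ | inj₁ (inj₁ _) , () | _
... | _ | inj₂ _ , ()        | _
... | _ | _ | inj₁ (inj₁ _) , ()
... | _ | _ | inj₁ (inj₂ _) , ()

UnionOfThreeCliques : Graph → Set
UnionOfThreeCliques G =
  Σ ℕ λ p → Σ ℕ λ q → Σ ℕ λ r → 0 < p × 0 < q × 0 < r × (G ≅ K3 p q r)

cliquePartition⇒unionOfThreeCliques : ∀ {G} {f : Fin (n G) → Fin 3} →
  CliquePartition G f → StrictlySurjective _≡_ f → UnionOfThreeCliques G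
cliquePartition⇒unionOfThreeCliques {G} {f} cp f-surj with blockSorting f
... | record { sizes = p , q , r ; sort = σ ; tag-sort = tag-σ } =
  let (p>0 , q>0 , r>0) = tags-surjective⇒positive tags-surj in
  p , q , r , p>0 , q>0 , r>0 ,
  cliquePartition-≅ cp (K3-cliquePartition p q r) (↔-sym (blocks↔ p q r) ↔-∘ σ) class-σ
  where
  tags-surj : StrictlySurjective _≡_ tag
  tags-surj t = let (u , fu≡t) = f-surj t in Inverse.to σ u , ≡.trans (tag-σ u) fu≡t
  class-σ : ∀ u → blockClass p q r (Inverse.from (blocks↔ p q r) (Inverse.to σ u)) ≡ f u
  class-σ u = ≡.trans (cong tag (Inverse.strictlyInverseˡ (blocks↔ p q r) _)) (tag-σ u)

cyclic : ∀ {m} → (Fin m → Fin 3) → Digraph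
cyclic {m} f = record { m = m ; Arc = λ u v → rotate (f u) ≡ f v }

module _ {m} {f : Fin m → Fin 3} (f-surj : StrictlySurjective _≡_ f) where

  cyclic-isTournament : IsMultipartiteTournament 3 (cyclic f)
  cyclic-isTournament = record
    { part      = f
    ; part-surj = f-surj
    ; noArcIn   = λ u v fu≡fv uv → rotate-fixfree (f u) (≡.trans uv (≡.sym fu≡fv))
    ; someArc   = λ u v → rotate-total (f u) (f v)
    ; notBoth   = λ u v (uv , vu) → rotate-asym uv vu
    }

  cyclic-cliquePartition : CliquePartition (niche (cyclic f)) f
  cyclic-cliquePartition = record
    { adjacent⇒same = λ
        { (_ , inj₁ (_ , uw , vw)) → rotate-injective (≡.trans uw (≡.sym vw))
        ; (_ , inj₂ (_ , wu , wv)) → ≡.trans (≡.sym wu) wv }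
    ; same⇒adjacent = λ {u} fu≡fv u≢v →
        let (w , fw≡) = f-surj (rotate (f u)) in
        u≢v , inj₁ (w , ≡.sym fw≡ , ≡.trans (cong rotate (≡.sym fu≡fv)) (≡.sym fw≡))
    }

blockClass-surjective : ∀ {p q r} → 0 < p → 0 < q → 0 < r →
                        StrictlySurjective _≡_ (blockClass p q r)
blockClass-surjective {p} {q} {r} p>0 q>0 r>0 = λ
  { 0F → preimage (inj₁ (inj₁ (fromℕ< p>0)))
  ; 1F → preimage (inj₁ (inj₂ (fromℕ< q>0)))
  ; 2F → preimage (inj₂ (fromℕ< r>0)) }
  where
  open Inverse (blocks↔ p q r)
  preimage : ∀ b → ∃[ i ] blockClass p q r i ≡ tag b
  preimage b = from b , cong tag (strictlyInverseˡ b)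

module MultipartiteTournament {k} {D : Digraph} (T : IsMultipartiteTournament k D) where
  open Digraph D
  open IsMultipartiteTournament T

  Connected : Fin m → Fin m → Set
  Connected = Reach (niche D)

  CommonNeighbour : Fin m → Fin m → Set
  CommonNeighbour x y = (∃[ w ] (Arc x w × Arc y w)) ⊎ (∃[ w ] (Arc w x × Arc w y))

  commonNeighbour⇒connected : ∀ {x y} → CommonNeighbour x y → Connected x y
  commonNeighbour⇒connected {x} {y} xy with x ≟ y
  ... | yes refl = here
  ... | no x≢y   = step (x≢y , xy) here

  two-of-three-share-neighbour : ∀ {x y z w} →
    part x ≢ part w → part y ≢ part w → part z ≢ part w →
    CommonNeighbour x y ⊎ CommonNeighbour x z ⊎ CommonNeighbour y z
  two-of-three-share-neighbour {x} {y} {z} {w} x≁w y≁w z≁w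
    with someArc x w x≁w | someArc y w y≁w | someArc z w z≁w
  ... | inj₁ xw | inj₁ yw | _       = inj₁ (inj₁ (w , xw , yw))
  ... | inj₂ wx | inj₂ wy | _       = inj₁ (inj₂ (w , wx , wy))
  ... | inj₁ xw | inj₂ _  | inj₁ zw = inj₂ (inj₁ (inj₁ (w , xw , zw)))
  ... | inj₂ wx | inj₁ _  | inj₂ wz = inj₂ (inj₁ (inj₂ (w , wx , wz)))
  ... | inj₁ _  | inj₂ wy | inj₂ wz = inj₂ (inj₂ (inj₂ (w , wy , wz)))
  ... | inj₂ _  | inj₁ yw | inj₁ zw = inj₂ (inj₂ (inj₁ (w , yw , zw)))

  module Components (R : ThreeRepresentatives (niche D)) (k≥3 : k ≥ 3) where
    open ThreeRepresentatives R

    connected-reps⇒≡ : ∀ {x s t} → Connected x (rep s) → Connected x (rep t) → s ≡ t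
    connected-reps⇒≡ {s = s} {t} xs xt with s ≟ t
    ... | yes s≡t = s≡t
    ... | no s≢t  = contradiction (reach-trans (reach-sym xs) xt) (separated s≢t)

    neighbour-of-rep⇒≡ : ∀ {x s t} → CommonNeighbour x (rep s) → Connected x (rep t) → s ≡ t
    neighbour-of-rep⇒≡ xs = connected-reps⇒≡ (commonNeighbour⇒connected xs)

    every-part-has-rep : ∀ w → ∃[ t ] part (rep t) ≡ part w
    every-part-has-rep w with any? (λ t → part (rep t) ≟ part w)
    ... | yes found = found
    ... | no none   = absurd (two-of-three-share-neighbour (avoid 0F) (avoid 1F) (avoid 2F))
      where
      avoid : ∀ t → part (rep t) ≢ part w
      avoid t e = none (t , e)
      absurd : ∀ {A : Set} →
        CommonNeighbour (rep 0F) (rep 1F) ⊎ CommonNeighbour (rep 0F) (rep 2F) ⊎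
        CommonNeighbour (rep 1F) (rep 2F) → A
      absurd (inj₁ cn)        = contradiction (neighbour-of-rep⇒≡ cn here) λ ()
      absurd (inj₂ (inj₁ cn)) = contradiction (neighbour-of-rep⇒≡ cn here) λ ()
      absurd (inj₂ (inj₂ cn)) = contradiction (neighbour-of-rep⇒≡ cn here) λ ()

    rep-parts-surjective : StrictlySurjective _≡_ (part ∘ rep)
    rep-parts-surjective i =
      let (w , w∈i) = part-surj i ; (t , t~w) = every-part-has-rep w in t , ≡.trans t~w w∈i

    k≡3 : k ≡ 3
    k≡3 = ℕ.≤-antisym (surjective⇒≤ (part ∘ rep) rep-parts-surjective) k≥3

    rep-parts-distinct : ∀ {s t} → s ≢ t → part (rep s) ≢ part (rep t)
    rep-parts-distinct s≢t = s≢t ∘ surjective⇒injective (part ∘ rep) rep-parts-surjective k≥3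

    connected⇒same-part : ∀ {x t} → Connected x (rep t) → part x ≡ part (rep t)
    connected⇒same-part {x} {t} xt with part x ≟ part (rep t)
    ... | yes same = same
    ... | no x≁t
      with two-of-three-share-neighbour x≁t (rep-parts-distinct (rotate-fixfree t))
                                             (rep-parts-distinct (rotate²-fixfree t))
    ...   | inj₁ cn        = contradiction (neighbour-of-rep⇒≡ cn xt) (rotate-fixfree t)
    ...   | inj₂ (inj₁ cn) = contradiction (neighbour-of-rep⇒≡ cn xt) (rotate²-fixfree t)
    ...   | inj₂ (inj₂ cn) = contradiction (neighbour-of-rep⇒≡ cn here) (rotate-fixfree (rotate t))

    -- The common neighbour is found in the part of the next representative.
    same-component⇒adjacent : ∀ {u v t} → Connected u (rep t) → Connected v (rep t) →
                              u ≢ v → NicheAdj D u v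
    same-component⇒adjacent {u} {v} {t} ut vt u≢v
      with two-of-three-share-neighbour (apart ut) (apart vt)
                                        (rep-parts-distinct (rotate-fixfree (rotate t)))
      where
      apart : ∀ {x} → Connected x (rep t) → part x ≢ part (rep (rotate t))
      apart xt e = rep-parts-distinct (rotate-fixfree t)
                                      (≡.trans (≡.sym e) (connected⇒same-part xt))
    ... | inj₁ cn        = u≢v , cn
    ... | inj₂ (inj₁ cn) = contradiction (neighbour-of-rep⇒≡ cn ut) (rotate²-fixfree t)
    ... | inj₂ (inj₂ cn) = contradiction (neighbour-of-rep⇒≡ cn vt) (rotate²-fixfree t)

    component : Fin m → Fin 3
    component = proj₁ ∘ covering

    component-surjective : StrictlySurjective _≡_ component
    component-surjective t = rep t , connected-reps⇒≡ (proj₂ (covering (rep t))) here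

    niche-cliquePartition : CliquePartition (niche D) component
    niche-cliquePartition = record
      { adjacent⇒same = λ {u} {v} uv →
          connected-reps⇒≡ (proj₂ (covering u)) (step uv (proj₂ (covering v)))
      ; same⇒adjacent = λ {u} {v} same → same-component⇒adjacent (proj₂ (covering u))
          (subst (Connected v ∘ rep) (≡.sym same) (proj₂ (covering v)))
      }

realizable⇒unionOfThreeCliques : ∀ {G k} → ThreeComponents G → k ≥ 3 →
                                 NicheRealizable G k → k ≡ 3 × UnionOfThreeCliques G
realizable⇒unionOfThreeCliques components k≥3 (D , T , G≅D) =
  let open MultipartiteTournament.Components T
             (threeRepresentatives-≅ G≅D (threeRepresentatives components)) k≥3
      (p , q , r , p>0 , q>0 , r>0 , D≅K3) =
        cliquePartition⇒unionOfThreeCliques niche-cliquePartition component-surjective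
  in k≡3 , p , q , r , p>0 , q>0 , r>0 , ≅-trans G≅D D≅K3

unionOfThreeCliques⇒realizable : ∀ {G} → UnionOfThreeCliques G → NicheRealizable G 3
unionOfThreeCliques⇒realizable (p , q , r , p>0 , q>0 , r>0 , G≅K3) =
  cyclic (blockClass p q r) , cyclic-isTournament surj ,
  ≅-trans G≅K3 (cliquePartition-≅ (K3-cliquePartition p q r) (cyclic-cliquePartition surj)
                                  (↔-id _) λ _ → refl)
  where
  surj : StrictlySurjective _≡_ (blockClass p q r)
  surj = blockClass-surjective p>0 q>0 r>0

theorem3p1 : (G : Graph) → ThreeComponents G → (k : ℕ) → k ≥ 3 →
    (NicheRealizable G k → (k ≡ 3 × Σ ℕ λ p → Σ ℕ λ q → Σ ℕ λ r → 0 < p × 0 < q × 0 < r × (G ≅ K3 p q r)))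
    × ((k ≡ 3 × Σ ℕ λ p → Σ ℕ λ q → Σ ℕ λ r → 0 < p × 0 < q × 0 < r × (G ≅ K3 p q r)) → NicheRealizable G k)
theorem3p1 G components k k≥3 =
  realizable⇒unionOfThreeCliques components k≥3 ,
  λ (k≡3 , cliques) →
    subst (NicheRealizable G) (≡.sym k≡3) (unionOfThreeCliques⇒realizable cliques)
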